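{- A subset $A\subseteq\mathbb{B}^m$ is downward closed if and only if there exists a diagram $d:m\to 0$ in pre-normal form such that $[\![d]\!]=A$ (identifying a relation between $\mathbb{B}^m$ and the one-element set with a subset of $\mathbb{B}^m$).
   Context: $\mathbb{B}=\{0,1\}$ with $0\le1$, $\mathbb{B}^m$ ordered componentwise. Diagrams are built from the generators copy $1\to2$, discard $1\to0$, conjunction $2\to1$, unit $0\to1$, counit $1\to0$ (among others), identities and symmetries, by sequential and parallel composition, and interpreted as relations: copy $=\{(x,(y_1,y_2))\mid x\le y_1,x\le y_2\}$, discard $=\{(x,\bullet)\}$, conjunction $=\{((x_1,x_2),y)\mid x_1\land x_2\le y\}$, unit $=\{(\bullet,1)\}$, counit $=\{(0,\bullet)\}$, identity $=\{(x,y)\mid x\le y\}$, symmetry permutes coordinates; sequential composition is relational composition and parallel composition is the product. A matrix diagram is $c_1;c_2$ with $c_1$ built only from copy, discard, identities, symmetries and $c_2$ only from conjunction, unit, identities, symmetries. A diagram $d:m\to0$ is in pre-normal form if $d=d_1;(\text{counit})^{\otimes n}$ for some matrix diagram $d_1:m\to n$. -}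

module Defs where

open import Data.Nat using (ℕ; zero; suc; _+_)
open import Data.Bool using (Bool; true; false; _∧_) renaming (_≤_ to _≤ᵇ_)
open import Data.Vec using (Vec; []; _∷_; take; drop)
open import Data.Vec.Relation.Binary.Pointwise.Inductive using (Pointwise)
open import Data.Product using (Σ; _×_; ∃)
open import Data.Unit using (⊤)
open import Relation.Binary.PropositionalEquality using (_≡_)

_≤ᵛ_ : ∀ {m} → Vec Bool m → Vec Bool m → Set
_≤ᵛ_ = Pointwise _≤ᵇ_

data Diag : ℕ → ℕ → Set where
  copy    : Diag 1 2
  discard : Diag 1 0
  conj    : Diag 2 1
  unit    : Diag 0 1
  counit  : Diag 1 0
  idw     : Diag 1 1
  id0     : Diag 0 0
  swap    : Diag 2 2
  _⨾_     : ∀ {m n k} → Diag m n → Diag n k → Diag m k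
  _⊗_     : ∀ {m n m' n'} → Diag m n → Diag m' n' → Diag (m + m') (n + n')

infixl 5 _⨾_
infixl 6 _⊗_

copyR : Vec Bool 1 → Vec Bool 2 → Set
copyR (x ∷ []) (y₁ ∷ y₂ ∷ []) = (x ≤ᵇ y₁) × (x ≤ᵇ y₂)

conjR : Vec Bool 2 → Vec Bool 1 → Set
conjR (x₁ ∷ x₂ ∷ []) (y ∷ []) = (x₁ ∧ x₂) ≤ᵇ y

unitR : Vec Bool 0 → Vec Bool 1 → Set
unitR [] (y ∷ []) = y ≡ true

counitR : Vec Bool 1 → Vec Bool 0 → Set
counitR (x ∷ []) [] = x ≡ false

idR : Vec Bool 1 → Vec Bool 1 → Set
idR (x ∷ []) (y ∷ []) = x ≤ᵇ y

swapR : Vec Bool 2 → Vec Bool 2 → Set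
swapR (a ∷ b ∷ []) (c ∷ d ∷ []) = (c ≡ b) × (d ≡ a)

⟦_⟧ : ∀ {m n} → Diag m n → Vec Bool m → Vec Bool n → Set
⟦ copy ⟧    x y = copyR x y
⟦ discard ⟧ x y = ⊤
⟦ conj ⟧    x y = conjR x y
⟦ unit ⟧    x y = unitR x y
⟦ counit ⟧  x y = counitR x y
⟦ idw ⟧     x y = idR x y
⟦ id0 ⟧     x y = ⊤
⟦ swap ⟧    x y = swapR x y
⟦ _⨾_ {n = n} d e ⟧ x y = Σ (Vec Bool n) λ z → ⟦ d ⟧ x z × ⟦ e ⟧ z y
⟦ _⊗_ {m} {n} d e ⟧ x y = ⟦ d ⟧ (take m x) (take n y) × ⟦ e ⟧ (drop m x) (drop n y)

data CopyOnly : ∀ {m n} → Diag m n → Set where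
  c-copy    : CopyOnly copy
  c-discard : CopyOnly discard
  c-idw     : CopyOnly idw
  c-id0     : CopyOnly id0
  c-swap    : CopyOnly swap
  c-seq     : ∀ {m n k} {d : Diag m n} {e : Diag n k} → CopyOnly d → CopyOnly e → CopyOnly (d ⨾ e)
  c-par     : ∀ {m n m' n'} {d : Diag m n} {e : Diag m' n'} → CopyOnly d → CopyOnly e → CopyOnly (d ⊗ e)

data ConjOnly : ∀ {m n} → Diag m n → Set where
  a-conj    : ConjOnly conj
  a-unit    : ConjOnly unit
  a-idw     : ConjOnly idw
  a-id0     : ConjOnly id0
  a-swap    : ConjOnly swap
  a-seq     : ∀ {m n k} {d : Diag m n} {e : Diag n k} → ConjOnly d → ConjOnly e → ConjOnly (d ⨾ e)
  a-par     : ∀ {m n m' n'} {d : Diag m n} {e : Diag m' n'} → ConjOnly d → ConjOnly e → ConjOnly (d ⊗ e)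

IsMatrix : ∀ {m n} → Diag m n → Set
IsMatrix {m} {n} d = Σ ℕ λ k → Σ (Diag m k) λ c₁ → Σ (Diag k n) λ c₂ →
  CopyOnly c₁ × ConjOnly c₂ × (d ≡ c₁ ⨾ c₂)

counits : (n : ℕ) → Diag n 0
counits zero    = id0
counits (suc n) = counit ⊗ counits n

PreNormal : ∀ {m} → Diag m 0 → Set
PreNormal {m} d = Σ ℕ λ n → Σ (Diag m n) λ d₁ → IsMatrix d₁ × (d ≡ d₁ ⨾ counits n)

-- subsets of 𝔹^m (decidable, as all subsets of a finite set classically are)
DownClosed : ∀ {m} → (Vec Bool m → Bool) → Set
DownClosed {m} A = (x y : Vec Bool m) → y ≤ᵛ x → A x ≡ true → A y ≡ true

-- Every generator denotes a relation R that can be simulated below its input: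
-- from x' ≤ x and x R y we get some y' ≤ y with x' R y', and sequential and
-- parallel composition preserve this.  For d : m → 0 it says exactly that ⟦ d ⟧
-- is downward closed.
--
-- Conversely, a downward closed A consists of the x above which no non-member
-- C of A lies.  The test C ≤ x is the conjunction of the coordinates of x that C
-- selects; copy and discard perform the selections, conjunction and unit the
-- conjunctions, so one matrix diagram computes all tests at once, and the
-- counits demand that every test fails.
module Submission where

open import Defs
open import Data.Nat using (ℕ; zero; suc; _+_)
open import Data.Bool using (Bool; true; false; _∧_; f≤t; b≤b) renaming (_≤_ to _≤ᵇ_)
open import Data.Bool.Properties using (not-¬; ¬-not)
  renaming (≤-trans to ≤ᵇ-trans; ≤-minimum to false-≤ᵇ; _≟_ to _≟ᵇ_)
open import Data.Vec using (Vec; []; _∷_; _++_; take; drop; head; tail; replicate)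
open import Data.Vec.Properties using (take++drop≡id; ∷-injectiveˡ; ∷-injectiveʳ)
open import Data.Vec.Relation.Binary.Pointwise.Inductive as Pointwise using (Pointwise; []; _∷_; ++⁺)
open import Data.List using (List; []; _∷_; length; map; filter) renaming (_++_ to _++ˡ_)
open import Data.Nat.ListAction using (sum)
open import Data.List.Membership.Propositional using (_∈_)
open import Data.List.Membership.Propositional.Properties
  using (∈-map⁺; ∈-++⁺ˡ; ∈-++⁺ʳ; ∈-filter⁺)
open import Data.List.Relation.Unary.Any using (here)
open import Data.List.Relation.Unary.All as All using (All; []; _∷_)
open import Data.List.Relation.Unary.All.Properties using (all-filter)
open import Data.Product using (Σ; ∃-syntax; _×_; _,_)
open import Data.Unit using (tt)
open import Relation.Nullary using (Dec)
open import Function using (id; _∘_)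
open import Function.Bundles using (_⇔_; mk⇔; Equivalence)
open import Function.Construct.Composition using (_⇔-∘_)
open import Function.Construct.Symmetry using (⇔-sym)
open import Relation.Binary.PropositionalEquality using (_≡_; _≗_; refl; sym; trans; cong; cong₂; subst)

private variable
  m n k : ℕ

∧-mono-≤ᵇ : ∀ {a a' b b'} → a' ≤ᵇ a → b' ≤ᵇ b → a' ∧ b' ≤ᵇ a ∧ b
∧-mono-≤ᵇ {false} b≤b _ = b≤b
∧-mono-≤ᵇ {true} {b = b} f≤t _ = false-≤ᵇ b
∧-mono-≤ᵇ {true} b≤b q = q

module _ {A : Set} where

  take-++ : ∀ m (x : Vec A m) (y : Vec A n) → take m (x ++ y) ≡ x
  take-++ zero [] y = refl
  take-++ (suc m) (a ∷ x) y = cong (a ∷_) (take-++ m x y)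

  drop-++ : ∀ m (x : Vec A m) (y : Vec A n) → drop m (x ++ y) ≡ y
  drop-++ zero [] y = refl
  drop-++ (suc m) (a ∷ x) y = drop-++ m x y

module _ {A B : Set} {R : A → B → Set} where

  take⁺ : ∀ m {x : Vec A (m + n)} {y : Vec B (m + n)} → Pointwise R x y → Pointwise R (take m x) (take m y)
  take⁺ zero _ = []
  take⁺ (suc m) (r ∷ rs) = r ∷ take⁺ m rs

  drop⁺ : ∀ m {x : Vec A (m + n)} {y : Vec B (m + n)} → Pointwise R x y → Pointwise R (drop m x) (drop m y)
  drop⁺ zero rs = rs
  drop⁺ (suc m) (r ∷ rs) = drop⁺ m rs

≤ᵛ-refl : {x : Vec Bool n} → x ≤ᵛ x
≤ᵛ-refl = Pointwise.refl b≤b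

≤ᵛ-trans : {x y z : Vec Bool n} → x ≤ᵛ y → y ≤ᵛ z → x ≤ᵛ z
≤ᵛ-trans = Pointwise.trans ≤ᵇ-trans

++-≤ᵛ-take-drop : ∀ n {y : Vec Bool (n + k)} {y₁ y₂} →
                  y₁ ≤ᵛ take n y → y₂ ≤ᵛ drop n y → (y₁ ++ y₂) ≤ᵛ y
++-≤ᵛ-take-drop n {y = y} p q = subst (_ ≤ᵛ_) (take++drop≡id n y) (++⁺ p q)

≤ᵛ-replicate-false : {x : Vec Bool n} → x ≤ᵛ replicate n false → x ≡ replicate n false
≤ᵛ-replicate-false [] = refl
≤ᵛ-replicate-false (b≤b ∷ ps) = cong (false ∷_) (≤ᵛ-replicate-false ps)

⟦⊗⟧-intro : ∀ {m n m' n'} {d : Diag m n} {e : Diag m' n'} {x : Vec Bool (m + m')} {y₁ y₂} →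
            ⟦ d ⟧ (take m x) y₁ → ⟦ e ⟧ (drop m x) y₂ → ⟦ d ⊗ e ⟧ x (y₁ ++ y₂)
⟦⊗⟧-intro {n = n} {y₁ = y₁} {y₂} r s rewrite take-++ n y₁ y₂ | drop-++ n y₁ y₂ = r , s

⟦⟧-simulateBelow : (d : Diag m n) {x x' : Vec Bool m} {y : Vec Bool n} →
                   x' ≤ᵛ x → ⟦ d ⟧ x y → ∃[ y' ] y' ≤ᵛ y × ⟦ d ⟧ x' y'
⟦⟧-simulateBelow copy {_ ∷ []} {_ ∷ []} {_ ∷ _ ∷ []} (p ∷ []) (q₁ , q₂) =
  _ , ≤ᵛ-refl , ≤ᵇ-trans p q₁ , ≤ᵇ-trans p q₂
⟦⟧-simulateBelow discard {y = []} _ _ = [] , [] , tt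
⟦⟧-simulateBelow conj {_ ∷ _ ∷ []} {_ ∷ _ ∷ []} {_ ∷ []} (p ∷ q ∷ []) r =
  _ , ≤ᵛ-refl , ≤ᵇ-trans (∧-mono-≤ᵇ p q) r
⟦⟧-simulateBelow unit {[]} {[]} _ r = _ , ≤ᵛ-refl , r
⟦⟧-simulateBelow counit {_ ∷ []} {_ ∷ []} {[]} (b≤b ∷ []) refl = [] , [] , refl
⟦⟧-simulateBelow idw {_ ∷ []} {_ ∷ []} {_ ∷ []} (p ∷ []) r = _ , ≤ᵛ-refl , ≤ᵇ-trans p r
⟦⟧-simulateBelow id0 {[]} {[]} _ _ = _ , ≤ᵛ-refl , tt
⟦⟧-simulateBelow swap {_ ∷ _ ∷ []} {_ ∷ _ ∷ []} {_ ∷ _ ∷ []} (p ∷ q ∷ []) (refl , refl) =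
  _ , q ∷ p ∷ [] , refl , refl
⟦⟧-simulateBelow (d ⨾ e) x'≤x (z , dz , ez) =
  let z' , z'≤z , dz' = ⟦⟧-simulateBelow d x'≤x dz
      y' , y'≤y , ez' = ⟦⟧-simulateBelow e z'≤z ez
  in  y' , y'≤y , z' , dz' , ez'
⟦⟧-simulateBelow (_⊗_ {m} {n} d e) x'≤x (r , s) =
  let y₁ , y₁≤ , r' = ⟦⟧-simulateBelow d (take⁺ m x'≤x) r
      y₂ , y₂≤ , s' = ⟦⟧-simulateBelow e (drop⁺ m x'≤x) s
  in  y₁ ++ y₂ , ++-≤ᵛ-take-drop n y₁≤ y₂≤ , ⟦⊗⟧-intro {d = d} {e} r' s'

⟦⟧-downClosed : (d : Diag m 0) {x y : Vec Bool m} → y ≤ᵛ x → ⟦ d ⟧ x [] → ⟦ d ⟧ y []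
⟦⟧-downClosed d y≤x r with ⟦⟧-simulateBelow d y≤x r
... | [] , _ , r' = r'

⟦⟧⇔-downClosed : (d : Diag m 0) {A : Vec Bool m → Bool} →
                 ((x : Vec Bool m) → ⟦ d ⟧ x [] ⇔ (A x ≡ true)) → DownClosed A
⟦⟧⇔-downClosed d ⟦d⟧⇔A x y y≤x Ax =
  Equivalence.to (⟦d⟧⇔A y) (⟦⟧-downClosed d y≤x (Equivalence.from (⟦d⟧⇔A x) Ax))

record Computes (d : Diag m n) (f : Vec Bool m → Vec Bool n) : Set where
  field
    attains : ∀ x → ⟦ d ⟧ x (f x)
    least   : ∀ {x y} → ⟦ d ⟧ x y → f x ≤ᵛ y
open Computes

Computes-≗ : {d : Diag m n} {f g : Vec Bool m → Vec Bool n} → f ≗ g → Computes d f → Computes d g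
Computes-≗ {d = d} f≗g c .attains x = subst (⟦ d ⟧ x) (f≗g x) (attains c x)
Computes-≗ f≗g c .least {x} r = subst (_≤ᵛ _) (f≗g x) (least c r)

Computes-⨾ : {d : Diag m n} {e : Diag n k} {f : Vec Bool m → Vec Bool n} {g : Vec Bool n → Vec Bool k} →
             Computes d f → Computes e g → Computes (d ⨾ e) (g ∘ f)
Computes-⨾ {f = f} cd ce .attains x = f x , attains cd x , attains ce (f x)
Computes-⨾ {e = e} cd ce .least (_ , dz , ez) =
  let y' , y'≤y , ez' = ⟦⟧-simulateBelow e (least cd dz) ez
  in  ≤ᵛ-trans (least ce ez') y'≤y

Computes-⊗ : ∀ {m n m' n'} {d : Diag m n} {e : Diag m' n'}
             {f : Vec Bool m → Vec Bool n} {g : Vec Bool m' → Vec Bool n'} →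
             Computes d f → Computes e g → Computes (d ⊗ e) (λ x → f (take m x) ++ g (drop m x))
Computes-⊗ {d = d} {e} cd ce .attains x = ⟦⊗⟧-intro {d = d} {e} (attains cd _) (attains ce _)
Computes-⊗ {n = n} cd ce .least (r , s) = ++-≤ᵛ-take-drop n (least cd r) (least ce s)

copy-computes : Computes copy (λ x → x ++ x)
copy-computes .attains (_ ∷ []) = b≤b , b≤b
copy-computes .least {_ ∷ []} {_ ∷ _ ∷ []} (p , q) = p ∷ q ∷ []

discard-computes : Computes discard (λ _ → [])
discard-computes .attains _ = tt
discard-computes .least {y = []} _ = []

conj-computes : Computes conj (λ { (a ∷ b ∷ []) → a ∧ b ∷ [] })
conj-computes .attains (_ ∷ _ ∷ []) = b≤b
conj-computes .least {_ ∷ _ ∷ []} {_ ∷ []} p = p ∷ []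

unit-computes : Computes unit (λ _ → true ∷ [])
unit-computes .attains [] = refl
unit-computes .least {[]} {_ ∷ []} refl = ≤ᵛ-refl

idw-computes : Computes idw id
idw-computes .attains (_ ∷ []) = b≤b
idw-computes .least {_ ∷ []} {_ ∷ []} p = p ∷ []

id0-computes : Computes id0 id
id0-computes .attains _ = tt
id0-computes .least {[]} {[]} _ = []

swap-computes : Computes swap (λ { (a ∷ b ∷ []) → b ∷ a ∷ [] })
swap-computes .attains (_ ∷ _ ∷ []) = refl , refl
swap-computes .least {_ ∷ _ ∷ []} {_ ∷ _ ∷ []} (refl , refl) = ≤ᵛ-refl

ids : ∀ n → Diag n n
ids zero = id0
ids (suc n) = idw ⊗ ids n

ids-computes : ∀ n → Computes (ids n) id
ids-computes zero = id0-computes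
ids-computes (suc n) = Computes-≗ (λ { (_ ∷ _) → refl }) (Computes-⊗ idw-computes (ids-computes n))

ids-copyOnly : ∀ n → CopyOnly (ids n)
ids-copyOnly zero = c-id0
ids-copyOnly (suc n) = c-par c-idw (ids-copyOnly n)

moveFirst : ∀ m k → Diag (suc (m + k)) (m + suc k)
moveFirst zero k = ids (suc k)
moveFirst (suc m) k = (swap ⊗ ids (m + k)) ⨾ (idw ⊗ moveFirst m k)

moveFirst-computes : ∀ m k → Computes (moveFirst m k) (λ x → take m (tail x) ++ head x ∷ drop m (tail x))
moveFirst-computes zero k = Computes-≗ (λ { (_ ∷ _) → refl }) (ids-computes (suc k))
moveFirst-computes (suc m) k = Computes-≗ (λ { (_ ∷ _ ∷ _) → refl })
  (Computes-⨾ (Computes-⊗ swap-computes (ids-computes (m + k)))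
              (Computes-⊗ idw-computes (moveFirst-computes m k)))

moveFirst-copyOnly : ∀ m k → CopyOnly (moveFirst m k)
moveFirst-copyOnly zero k = ids-copyOnly (suc k)
moveFirst-copyOnly (suc m) k = c-seq (c-par c-swap (ids-copyOnly (m + k))) (c-par c-idw (moveFirst-copyOnly m k))

copyAll : ∀ m → Diag m (m + m)
copyAll zero = id0
copyAll (suc m) = (copy ⊗ copyAll m) ⨾ (idw ⊗ moveFirst m m)

copyAll-computes : ∀ m → Computes (copyAll m) (λ x → x ++ x)
copyAll-computes zero = Computes-≗ (λ { [] → refl }) id0-computes
copyAll-computes (suc m) =
  Computes-≗ (λ { (a ∷ x) → cong (a ∷_) (cong₂ (λ u v → u ++ a ∷ v) (take-++ m x x) (drop-++ m x x)) })
    (Computes-⨾ (Computes-⊗ copy-computes (copyAll-computes m))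
                (Computes-⊗ idw-computes (moveFirst-computes m m)))

copyAll-copyOnly : ∀ m → CopyOnly (copyAll m)
copyAll-copyOnly zero = c-id0
copyAll-copyOnly (suc m) = c-seq (c-par c-copy (copyAll-copyOnly m)) (c-par c-idw (moveFirst-copyOnly m m))

discardAll : ∀ m → Diag m 0
discardAll zero = id0
discardAll (suc m) = discard ⊗ discardAll m

discardAll-computes : ∀ m → Computes (discardAll m) (λ _ → [])
discardAll-computes zero = Computes-≗ (λ { [] → refl }) id0-computes
discardAll-computes (suc m) = Computes-⊗ discard-computes (discardAll-computes m)

discardAll-copyOnly : ∀ m → CopyOnly (discardAll m)
discardAll-copyOnly zero = c-id0
discardAll-copyOnly (suc m) = c-par c-discard (discardAll-copyOnly m)

trues : Vec Bool m → ℕ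
trues [] = 0
trues (true ∷ C) = suc (trues C)
trues (false ∷ C) = trues C

selectᵛ : (C : Vec Bool m) → Vec Bool m → Vec Bool (trues C)
selectᵛ [] [] = []
selectᵛ (true ∷ C) (a ∷ x) = a ∷ selectᵛ C x
selectᵛ (false ∷ C) (_ ∷ x) = selectᵛ C x

select : (C : Vec Bool m) → Diag m (trues C)
select [] = id0
select (true ∷ C) = idw ⊗ select C
select (false ∷ C) = discard ⊗ select C

select-computes : (C : Vec Bool m) → Computes (select C) (selectᵛ C)
select-computes [] = Computes-≗ (λ { [] → refl }) id0-computes
select-computes (true ∷ C) =
  Computes-≗ (λ { (_ ∷ _) → refl }) (Computes-⊗ idw-computes (select-computes C))
select-computes (false ∷ C) =
  Computes-≗ (λ { (_ ∷ _) → refl }) (Computes-⊗ discard-computes (select-computes C))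

select-copyOnly : (C : Vec Bool m) → CopyOnly (select C)
select-copyOnly [] = c-id0
select-copyOnly (true ∷ C) = c-par c-idw (select-copyOnly C)
select-copyOnly (false ∷ C) = c-par c-discard (select-copyOnly C)

and : Vec Bool k → Bool
and [] = true
and (a ∷ x) = a ∧ and x

conjAll : ∀ k → Diag k 1
conjAll zero = unit
conjAll (suc k) = (idw ⊗ conjAll k) ⨾ conj

conjAll-computes : ∀ k → Computes (conjAll k) (λ x → and x ∷ [])
conjAll-computes zero = Computes-≗ (λ { [] → refl }) unit-computes
conjAll-computes (suc k) = Computes-≗ (λ { (_ ∷ _) → refl })
  (Computes-⨾ (Computes-⊗ idw-computes (conjAll-computes k)) conj-computes)

conjAll-conjOnly : ∀ k → ConjOnly (conjAll k)
conjAll-conjOnly zero = a-unit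
conjAll-conjOnly (suc k) = a-seq (a-par a-idw (conjAll-conjOnly k)) a-conj

isBelow : Vec Bool m → Vec Bool m → Bool
isBelow C x = and (selectᵛ C x)

isBelow⇒≤ᵛ : (C x : Vec Bool m) → isBelow C x ≡ true → C ≤ᵛ x
isBelow⇒≤ᵛ [] [] _ = []
isBelow⇒≤ᵛ (true ∷ C) (true ∷ x) below = b≤b ∷ isBelow⇒≤ᵛ C x below
isBelow⇒≤ᵛ (false ∷ C) (a ∷ x) below = false-≤ᵇ a ∷ isBelow⇒≤ᵛ C x below

≤ᵛ⇒isBelow : {C x : Vec Bool m} → C ≤ᵛ x → isBelow C x ≡ true
≤ᵛ⇒isBelow [] = refl
≤ᵛ⇒isBelow {C = true ∷ _} (b≤b ∷ ps) = ≤ᵛ⇒isBelow ps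
≤ᵛ⇒isBelow {C = false ∷ _} (_ ∷ ps) = ≤ᵛ⇒isBelow ps

selections : (Cs : List (Vec Bool m)) → Diag m (sum (map trues Cs))
selections {m} [] = discardAll m
selections {m} (C ∷ Cs) = copyAll m ⨾ (select C ⊗ selections Cs)

selectionsᵛ : (Cs : List (Vec Bool m)) → Vec Bool m → Vec Bool (sum (map trues Cs))
selectionsᵛ [] x = []
selectionsᵛ (C ∷ Cs) x = selectᵛ C x ++ selectionsᵛ Cs x

selections-computes : (Cs : List (Vec Bool m)) → Computes (selections Cs) (selectionsᵛ Cs)
selections-computes {m} [] = discardAll-computes m
selections-computes {m} (C ∷ Cs) =
  Computes-≗ (λ x → cong₂ _++_ (cong (selectᵛ C) (take-++ m x x))
                               (cong (selectionsᵛ Cs) (drop-++ m x x)))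
    (Computes-⨾ (copyAll-computes m) (Computes-⊗ (select-computes C) (selections-computes Cs)))

selections-copyOnly : (Cs : List (Vec Bool m)) → CopyOnly (selections Cs)
selections-copyOnly {m} [] = discardAll-copyOnly m
selections-copyOnly {m} (C ∷ Cs) =
  c-seq (copyAll-copyOnly m) (c-par (select-copyOnly C) (selections-copyOnly Cs))

conjunctions : (Cs : List (Vec Bool m)) → Diag (sum (map trues Cs)) (length Cs)
conjunctions [] = id0
conjunctions (C ∷ Cs) = conjAll (trues C) ⊗ conjunctions Cs

conjunctionsᵛ : (Cs : List (Vec Bool m)) → Vec Bool (sum (map trues Cs)) → Vec Bool (length Cs)
conjunctionsᵛ [] z = []
conjunctionsᵛ (C ∷ Cs) z = and (take (trues C) z) ∷ conjunctionsᵛ Cs (drop (trues C) z)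

conjunctions-computes : (Cs : List (Vec Bool m)) → Computes (conjunctions Cs) (conjunctionsᵛ Cs)
conjunctions-computes [] = Computes-≗ (λ { [] → refl }) id0-computes
conjunctions-computes (C ∷ Cs) = Computes-⊗ (conjAll-computes (trues C)) (conjunctions-computes Cs)

conjunctions-conjOnly : (Cs : List (Vec Bool m)) → ConjOnly (conjunctions Cs)
conjunctions-conjOnly [] = a-id0
conjunctions-conjOnly (C ∷ Cs) = a-par (conjAll-conjOnly (trues C)) (conjunctions-conjOnly Cs)

isBelowEach : (Cs : List (Vec Bool m)) → Vec Bool m → Vec Bool (length Cs)
isBelowEach [] x = []
isBelowEach (C ∷ Cs) x = isBelow C x ∷ isBelowEach Cs x

conjunctionsᵛ-selectionsᵛ : (Cs : List (Vec Bool m)) (x : Vec Bool m) →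
                            conjunctionsᵛ Cs (selectionsᵛ Cs x) ≡ isBelowEach Cs x
conjunctionsᵛ-selectionsᵛ [] x = refl
conjunctionsᵛ-selectionsᵛ (C ∷ Cs) x = cong₂ _∷_
  (cong and (take-++ (trues C) (selectᵛ C x) (selectionsᵛ Cs x)))
  (trans (cong (conjunctionsᵛ Cs) (drop-++ (trues C) (selectᵛ C x) (selectionsᵛ Cs x)))
         (conjunctionsᵛ-selectionsᵛ Cs x))

belowTests : (Cs : List (Vec Bool m)) → Diag m (length Cs)
belowTests Cs = selections Cs ⨾ conjunctions Cs

belowTests-computes : (Cs : List (Vec Bool m)) → Computes (belowTests Cs) (isBelowEach Cs)
belowTests-computes Cs = Computes-≗ (conjunctionsᵛ-selectionsᵛ Cs)
  (Computes-⨾ (selections-computes Cs) (conjunctions-computes Cs))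

belowTests-isMatrix : (Cs : List (Vec Bool m)) → IsMatrix (belowTests Cs)
belowTests-isMatrix Cs =
  _ , selections Cs , conjunctions Cs , selections-copyOnly Cs , conjunctions-conjOnly Cs , refl

counits⇒replicate-false : ∀ n {y : Vec Bool n} → ⟦ counits n ⟧ y [] → y ≡ replicate n false
counits⇒replicate-false zero {[]} _ = refl
counits⇒replicate-false (suc n) {_ ∷ _} (refl , r) = cong (false ∷_) (counits⇒replicate-false n r)

counits-replicate-false : ∀ n → ⟦ counits n ⟧ (replicate n false) []
counits-replicate-false zero = tt
counits-replicate-false (suc n) = refl , counits-replicate-false n

Computes-⨾-counits : {d : Diag m n} {f : Vec Bool m → Vec Bool n} → Computes d f →
                     (x : Vec Bool m) → ⟦ d ⨾ counits n ⟧ x [] ⇔ f x ≡ replicate n false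
Computes-⨾-counits {n = n} {f = f} cd x = mk⇔
  (λ (y , r , c) → ≤ᵛ-replicate-false (subst (f x ≤ᵛ_) (counits⇒replicate-false n c) (least cd r)))
  (λ fx≡0 → f x , attains cd x ,
             subst (λ y → ⟦ counits n ⟧ y []) (sym fx≡0) (counits-replicate-false n))

isBelowEach≡false⇔All : (Cs : List (Vec Bool m)) (x : Vec Bool m) →
                         isBelowEach Cs x ≡ replicate (length Cs) false ⇔
                         All (λ C → isBelow C x ≡ false) Cs
isBelowEach≡false⇔All Cs x = mk⇔ (to Cs) (from Cs)
  where
  to : ∀ Cs → isBelowEach Cs x ≡ replicate (length Cs) false → All (λ C → isBelow C x ≡ false) Cs
  to [] _ = []
  to (C ∷ Cs) eq = ∷-injectiveˡ eq ∷ to Cs (∷-injectiveʳ eq)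
  from : ∀ Cs → All (λ C → isBelow C x ≡ false) Cs → isBelowEach Cs x ≡ replicate (length Cs) false
  from [] [] = refl
  from (C ∷ Cs) (p ∷ ps) = cong₂ _∷_ p (from Cs ps)

allVectors : ∀ m → List (Vec Bool m)
allVectors zero = [] ∷ []
allVectors (suc m) = map (true ∷_) (allVectors m) ++ˡ map (false ∷_) (allVectors m)

∈-allVectors : (x : Vec Bool m) → x ∈ allVectors m
∈-allVectors [] = here refl
∈-allVectors (true ∷ x) = ∈-++⁺ˡ (∈-map⁺ (true ∷_) (∈-allVectors x))
∈-allVectors (false ∷ x) = ∈-++⁺ʳ _ (∈-map⁺ (false ∷_) (∈-allVectors x))

nonMember? : (A : Vec Bool m → Bool) (C : Vec Bool m) → Dec (A C ≡ false)
nonMember? A C = A C ≟ᵇ false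

nonMembers : (Vec Bool m → Bool) → List (Vec Bool m)
nonMembers {m} A = filter (nonMember? A) (allVectors m)

downClosed⇒member⇔noNonMemberBelow : {A : Vec Bool m → Bool} → DownClosed A → (x : Vec Bool m) →
                                      A x ≡ true ⇔ All (λ C → isBelow C x ≡ false) (nonMembers A)
downClosed⇒member⇔noNonMemberBelow {m} {A} downClosed x = mk⇔
  (λ Ax → All.map (notBelow Ax) (all-filter (nonMember? A) (allVectors m)))
  (λ noneBelow → ¬-not {y = false} λ Ax≡false →
     not-¬ (≤ᵛ⇒isBelow {C = x} ≤ᵛ-refl)
           (All.lookup noneBelow (∈-filter⁺ (nonMember? A) (∈-allVectors x) Ax≡false)))
  where
  notBelow : A x ≡ true → {C : Vec Bool m} → A C ≡ false → isBelow C x ≡ false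
  notBelow Ax {C} AC≡false = ¬-not {y = true} λ below →
    not-¬ (downClosed x C (isBelow⇒≤ᵛ C x below) Ax) AC≡false

downClosed⇒preNormal : {A : Vec Bool m → Bool} → DownClosed A →
  Σ (Diag m 0) (λ d → PreNormal d × ((x : Vec Bool m) → (⟦ d ⟧ x [] ⇔ (A x ≡ true))))
downClosed⇒preNormal {m} {A} downClosed =
  belowTests Cs ⨾ counits (length Cs) ,
  (length Cs , belowTests Cs , belowTests-isMatrix Cs , refl) ,
  λ x → ⇔-sym (downClosed⇒member⇔noNonMemberBelow downClosed x)
          ⇔-∘ (isBelowEach≡false⇔All Cs x ⇔-∘ Computes-⨾-counits (belowTests-computes Cs) x)
  where
  Cs : List (Vec Bool m)
  Cs = nonMembers A

mainTheorem10 : (m : ℕ) (A : Vec Bool m → Bool) →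
    DownClosed A ⇔
      Σ (Diag m 0) (λ d → PreNormal d × ((x : Vec Bool m) → (⟦ d ⟧ x [] ⇔ (A x ≡ true))))
mainTheorem10 m A = mk⇔ downClosed⇒preNormal
  λ (d , _ , ⟦d⟧⇔A) → ⟦⟧⇔-downClosed d ⟦d⟧⇔A
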